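{- Let $G$ be a graph with a skeleton $\mathcal S=(F,D)$, let $H$ be a graph, let $\chi:V(H)\to V(G)\setminus(F\cup D)$, and let $P=P(G,\mathcal S,H,\chi)$. If there is an embedding $\bar h$ from $(G\setminus F)/D$ to $H$ with $\chi(\bar h(v))=v$ for every $v\in V(G)\setminus(F\cup D)$, then there is an embedding from $G$ to $P$.
   Context: All graphs are finite, simple, undirected. A homomorphism $G\to H$ is a map $h:V(G)\to V(H)$ with $h(u)h(v)\in E(H)$ whenever $uv\in E(G)$; an embedding is an injective homomorphism; an endomorphism of $G$ is a homomorphism $G\to G$. $G\setminus X$ denotes $G$ with the vertex set $X$ deleted. Quotient: for a graph $K$ and $D\subseteq V(K)$ such that every vertex of $D$ has degree at most $2$ in $K$, $K/D$ has vertex set $V(K)\setminus D$, and distinct $u,v$ are adjacent iff $K$ has a path from $u$ to $v$ whose internal vertices all lie in $D$. A vertex $x\in D$ is associated with a vertex $v$ of $K/D$ if $x$ lies on a path in $K$ between $v$ and some $w\in D$ of degree $1$ in $K$ whose internal vertices are all in $D$; $x$ is associated with an edge $vw$ of $K/D$ if $x$ lies on a path in $K$ between $v$ and $w$ whose internal vertices are all in $D$ (each $x$ is associated with at most one vertex or edge, not both). Frame: $F\subseteq V(G)$ is a frame for $G$ if every endomorphism $h$ of $G$ with $F\subseteq h(V(G))$ is surjective. Skeleton: a pair $(F,D)$ of subsets of $V(G)$ such that $F$ is a frame for $G$, $F\cap D=\emptyset$, and every $v\in D$ has at most $2$ neighbours in $V(G)\setminus F$. Below, "associated" refers to $K=G\setminus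 F$ and $K/D=(G\setminus F)/D$. Product graph $P=P(G,\mathcal S,H,\chi)$ for a skeleton $\mathcal S=(F,D)$, a graph $H$ and $\chi:V(H)\to V(G)\setminus(F\cup D)$: $V(P)=V_1\cup V_2\cup V_3\cup V_4$ where $V_1=\{(u,a)\mid u\in V(G)\setminus(F\cup D), a\in V(H), \chi(a)=u\}$; $V_2=\{(u,u)\mid u\in F$, or $u\in D$ is associated with no vertex and no edge of $(G\setminus F)/D\}$; $V_3=\{(u,\mathbf v_{u,a})\mid u\in D, a\in V(H), u$ is associated with the vertex $\chi(a)\}$; $V_4=\{(u,\mathbf v_{u,e})\mid u\in D, e=\{a,b\}\in E(H), u$ is associated with the edge $\{\chi(a),\chi(b)\}\}$, where all $\mathbf v_{u,a},\mathbf v_{u,e}$ are fresh elements. Edges (in all cases $uv\in E(G)$ is required): $(u,a)(v,b)$ for $(u,a),(v,b)\in V_1$ with $ab\in E(H)$; $(u,a)(v,v)$ for $(u,a)\in V_1$, $(v,v)\in V_2$; $(u,a)(v,\mathbf v_{v,a})$ for $(u,a)\in V_1$, $(v,\mathbf v_{v,a})\in V_3$; $(u,a)(v,\mathbf v_{v,e})$ for $(u,a)\in V_1$, $(v,\mathbf v_{v,e})\in V_4$ with $a\in e$; $(u,u)(v,v)$ for both in $V_2$; $(u,u)(v,z)$ for $(u,u)\in V_2$ and $(v,z)\in V_3\cup V_4$; $(u,\mathbf v_{u,a})(v,\mathbf v_{v,a})$ for both in $V_3$ (same $a$); $(u,\mathbf v_{u,e})(v,\mathbf v_{v,e})$ for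 both in $V_4$ (same $e$); no edges between $V_3$ and $V_4$. -}

module Defs where

open import Data.Nat using (ℕ)
open import Data.Fin using (Fin; _<_)
open import Data.Fin.Subset using (Subset; _∈_; _∉_)
open import Data.List using (List; []; _∷_; _++_)
open import Data.List.Relation.Unary.All using (All)
open import Data.List.Relation.Unary.Unique.Propositional using (Unique)
import Data.List.Membership.Propositional as L
open import Data.Product using (Σ; ∃; ∃-syntax; _×_; _,_)
open import Data.Sum using (_⊎_)
open import Data.Empty using (⊥)
open import Relation.Nullary using (¬_)
open import Relation.Binary using (Decidable)
open import Relation.Binary.PropositionalEquality using (_≡_; _≢_)

record Graph (n : ℕ) : Set₁ where
  field
    Adj     : Fin n → Fin n → Set
    adj?    : Decidable Adj
    sym     : ∀ {x y} → Adj x y → Adj y x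
    irrefl  : ∀ {x} → ¬ Adj x x
open Graph public

IsHom : ∀ {n m} → Graph n → Graph m → (Fin n → Fin m) → Set
IsHom G H h = ∀ x y → Adj G x y → Adj H (h x) (h y)

Injective : ∀ {A B : Set} → (A → B) → Set
Injective f = ∀ x y → f x ≡ f y → x ≡ y

IsFrame : ∀ {n} → Graph n → Subset n → Set
IsFrame {n} G F =
  (h : Fin n → Fin n) → IsHom G G h →
  (∀ f → f ∈ F → ∃[ x ] h x ≡ f) →
  ∀ y → ∃[ x ] h x ≡ y

IsSkeleton : ∀ {n} → Graph n → Subset n → Subset n → Set
IsSkeleton {n} G F D =
  IsFrame G F ×
  (∀ x → x ∈ F → x ∈ D → ⊥) ×
  (∀ v → v ∈ D → ∀ a b c → a ∉ F → b ∉ F → c ∉ F →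
     Adj G v a → Adj G v b → Adj G v c → a ≢ b → a ≢ c → b ≢ c → ⊥)

data Chain {n : ℕ} (E : Fin n → Fin n → Set) : Fin n → List (Fin n) → Fin n → Set where
  last : ∀ {u v} → E u v → Chain E u [] v
  step : ∀ {u x xs v} → E u x → Chain E x xs v → Chain E u (x ∷ xs) v

module _ {n : ℕ} (G : Graph n) (F D : Subset n) where

  DPath : Fin n → List (Fin n) → Fin n → Set
  DPath u xs v =
    Chain (Adj G) u xs v ×
    Unique (u ∷ xs ++ v ∷ []) ×
    All (λ y → y ∉ F) (u ∷ xs ++ v ∷ []) ×
    All (λ y → y ∈ D) xs

  QVertex : Fin n → Set
  QVertex v = v ∉ F × v ∉ D

  QEdge : Fin n → Fin n → Set
  QEdge u v = QVertex u × QVertex v × u ≢ v × ∃[ xs ] DPath u xs v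

  Degree1K : Fin n → Set
  Degree1K w = w ∉ F × ∃[ y ] (y ∉ F × Adj G w y × (∀ z → z ∉ F → Adj G w z → z ≡ y))

  AssocV : Fin n → Fin n → Set
  AssocV x v = x ∈ D × QVertex v ×
    ∃[ w ] (w ∈ D × Degree1K w × ∃[ xs ] (DPath v xs w × x L.∈ (v ∷ xs ++ w ∷ [])))

  AssocE : Fin n → Fin n → Fin n → Set
  AssocE x v w = x ∈ D × QEdge v w ×
    ∃[ xs ] (DPath v xs w × x L.∈ (v ∷ xs ++ w ∷ []))

  IsQEmbedding : ∀ {m} → Graph m → ((v : Fin n) → QVertex v → Fin m) → Set
  IsQEmbedding H h =
    (∀ v w (p : QVertex v) (q : QVertex w) → h v p ≡ h w q → v ≡ w) ×
    (∀ v w (p : QVertex v) (q : QVertex w) → QEdge v w → Adj H (h v p) (h w q))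

-- Raw vertices; the vertex set of P is the set of raw vertices satisfying InP.
--   r1 a      represents (χ(a), a)              (V₁)
--   r2 u      represents (u, u)                 (V₂)
--   r3 u a    represents (u, v_{u,a})           (V₃)
--   r4 u a b  represents (u, v_{u,{a,b}}), a < b (V₄; unordered edge {a,b} normalised)
module Product {n m : ℕ} (G : Graph n) (F D : Subset n) (H : Graph m) (χ : Fin m → Fin n) where

  data PVertex : Set where
    r1 : Fin m → PVertex
    r2 : Fin n → PVertex
    r3 : Fin n → Fin m → PVertex
    r4 : Fin n → Fin m → Fin m → PVertex

  InP : PVertex → Set
  InP (r1 a) = χ a ∉ F × χ a ∉ D
  InP (r2 u) = u ∈ F ⊎ (u ∈ D × (∀ v → ¬ AssocV G F D u v) × (∀ v w → ¬ AssocE G F D u v w))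
  InP (r3 u a) = AssocV G F D u (χ a)
  InP (r4 u a b) = a < b × Adj H a b × AssocE G F D u (χ a) (χ b)

  -- the edges as listed in the definition (one orientation)
  data PEdge0 : PVertex → PVertex → Set where
    e11 : ∀ {a b} → Adj G (χ a) (χ b) → Adj H a b → PEdge0 (r1 a) (r1 b)
    e12 : ∀ {a v} → Adj G (χ a) v → PEdge0 (r1 a) (r2 v)
    e13 : ∀ {a v} → Adj G (χ a) v → PEdge0 (r1 a) (r3 v a)
    e14 : ∀ {a v b c} → Adj G (χ a) v → (a ≡ b ⊎ a ≡ c) → PEdge0 (r1 a) (r4 v b c)
    e22 : ∀ {u v} → Adj G u v → PEdge0 (r2 u) (r2 v)
    e23 : ∀ {u v a} → Adj G u v → PEdge0 (r2 u) (r3 v a)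
    e24 : ∀ {u v b c} → Adj G u v → PEdge0 (r2 u) (r4 v b c)
    e33 : ∀ {u v a} → Adj G u v → PEdge0 (r3 u a) (r3 v a)
    e44 : ∀ {u v b c} → Adj G u v → PEdge0 (r4 u b c) (r4 v b c)

  PAdj : PVertex → PVertex → Set
  PAdj x y = InP x × InP y × (PEdge0 x y ⊎ PEdge0 y x)

  IsPEmbedding : (Fin n → PVertex) → Set
  IsPEmbedding f =
    (∀ x → InP (f x)) × Injective f × (∀ x y → Adj G x y → PAdj (f x) (f y))

-- Send F and the D-vertices associated with nothing to (u , u), a vertex v of (G ∖ F)/D to
-- (v , h̄ v), and a D-vertex associated with the vertex v (the edge vw) to the copy labelled
-- h̄ v ({h̄ v , h̄ w}). Since a vertex of D has at most two neighbours outside F, its neighbours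
-- outside F on a D-path are exactly its two path neighbours; so association passes along
-- edges of G between D-vertices, a neighbour outside D of an associated vertex is the
-- associated vertex or an end of the associated edge, and (tracing an association back along
-- the path) every D-vertex is associated with at most one vertex or edge. Hence adjacent
-- vertices of G get labels making their images adjacent in P.
module Submission where

open import Defs
open import Data.Nat using (ℕ; zero; suc; _≤_; z≤n; s≤s)
open import Data.Nat.Properties using (≤-trans; m≤n⇒m≤1+n; ≮⇒≥)
open import Data.Fin using (Fin; zero; suc; _<_; _≟_)
open import Data.Fin.Properties using (any?; all?; pigeonhole; <-irrefl; <-cmp; <-asym)
open import Data.Fin.Subset using (Subset; _∈_; _∉_)
open import Data.Fin.Subset.Properties using (_∈?_)
open import Data.List using (List; []; _∷_; _++_; _∷ʳ_; length; lookup; reverse)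
open import Data.List.Properties using (length-++-≤ˡ; unfold-reverse; reverse-++)
open import Data.List.Relation.Unary.All as All using (All; []; _∷_)
open import Data.List.Relation.Unary.AllPairs using ([]; _∷_)
open import Data.List.Relation.Unary.Any using (Any; here; there)
open import Data.List.Relation.Unary.Unique.Propositional using (Unique)
import Data.List.Relation.Unary.Unique.DecPropositional as UniqueDec
open import Data.List.Membership.Propositional using (lose) renaming (_∈_ to _∈ₗ_)
open import Data.List.Membership.Propositional.Properties using (∈-++⁻; ∈-++⁺ˡ; ∈-lookup)
import Data.List.Membership.DecPropositional as MembershipDec
open import Data.List.Relation.Binary.Permutation.Propositional using (_↭_; ↭-sym; ↭⇒↭ₛ)
open import Data.List.Relation.Binary.Permutation.Propositional.Properties
  using (↭-reverse; All-resp-↭; ∈-resp-↭)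
import Data.List.Relation.Binary.Permutation.Setoid.Properties as SetoidPermutation
open import Data.Product using (∃₂; ∃-syntax; _×_; _,_; proj₁; proj₂)
open import Data.Sum using (_⊎_; inj₁; inj₂)
open import Data.Unit using (tt)
open import Data.Empty using (⊥; ⊥-elim)
open import Relation.Nullary using (Dec; yes; no)
open import Relation.Nullary.Decidable using (map′; _×-dec_; _→-dec_; ¬?)
open import Relation.Binary using (Decidable; tri<; tri≈; tri>)
open import Relation.Binary.PropositionalEquality as ≡
  using (_≡_; _≢_; refl; cong; subst; subst₂; ≢-sym; module ≡-Reasoning)

vertices : ∀ {n} → Fin n → List (Fin n) → Fin n → List (Fin n)
vertices u xs v = u ∷ xs ++ v ∷ []

module _ {n : ℕ} {E : Fin n → Fin n → Set} where

  Chain-first : ∀ {u xs v} → Chain E u xs v → ∃[ s ] (s ∈ₗ xs ++ v ∷ [] × E u s)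
  Chain-first (last e) = _ , here refl , e
  Chain-first (step e _) = _ , here refl , e

  Chain-last : ∀ {u xs v} → Chain E u xs v → ∃[ p ] (p ∈ₗ u ∷ xs × E p v)
  Chain-last (last e) = _ , here refl , e
  Chain-last (step _ c) = let (p , p∈ , e) = Chain-last c in p , there p∈ , e

  Chain-snoc : ∀ {u xs v w} → Chain E u xs v → E v w → Chain E u (xs ++ v ∷ []) w
  Chain-snoc (last e) e′ = step e (last e′)
  Chain-snoc (step e c) e′ = step e (Chain-snoc c e′)

  Chain-backtrack : ∀ {P Q : Fin n → Set} → (∀ {a b} → Q a → E b a → P b → Q b) →
    ∀ {u xs v} → Chain E u xs v → All P xs → Any Q (xs ++ v ∷ []) → ∃[ z ] (E u z × Q z)
  Chain-backtrack _ (last e) [] (here q) = _ , e , q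
  Chain-backtrack _ (last _) [] (there ())
  Chain-backtrack _ (step e _) _ (here q) = _ , e , q
  Chain-backtrack back (step e c) (px ∷ pxs) (there q∈) =
    let (_ , e′ , q) = Chain-backtrack back c pxs q∈ in _ , e , back q e′ px

  chain? : Decidable E → ∀ u xs v → Dec (Chain E u xs v)
  chain? E? u [] v = map′ last (λ { (last e) → e }) (E? u v)
  chain? E? u (x ∷ xs) v =
    map′ (λ (e , c) → step e c) (λ { (step e c) → e , c }) (E? u x ×-dec chain? E? x xs v)

  module _ (E-sym : ∀ {a b} → E a b → E b a) where

    Chain-reverse : ∀ {u xs v} → Chain E u xs v → Chain E v (reverse xs) u
    Chain-reverse (last e) = last (E-sym e)
    Chain-reverse {u} {v = v} (step {x = x} {xs} e c) =
      subst (λ ys → Chain E v ys u) (≡.sym (unfold-reverse x xs)) (Chain-snoc (Chain-reverse c) (E-sym e))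

    Chain-neighbours : ∀ {u xs v x} → Chain E u xs v → Unique (vertices u xs v) → x ∈ₗ xs →
      ∃₂ λ p s → p ∈ₗ vertices u xs v × s ∈ₗ vertices u xs v × E x p × E x s × p ≢ s
    Chain-neighbours (step e c) (u∉ ∷ _) (here refl) =
      let (s , s∈ , e′) = Chain-first c
      in _ , s , here refl , there (there s∈) , E-sym e , e′ , All.lookup u∉ (there s∈)
    Chain-neighbours (step _ c) (_ ∷ uniq) (there x∈) =
      let (p , s , p∈ , s∈ , rest) = Chain-neighbours c uniq x∈
      in p , s , there p∈ , there s∈ , rest

module _ {n : ℕ} where

  lookup-injective : ∀ {xs : List (Fin n)} → Unique xs → ∀ i j → lookup xs i ≡ lookup xs j → i ≡ j
  lookup-injective (_ ∷ _) zero zero _ = refl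
  lookup-injective (x∉ ∷ _) zero (suc j) eq = ⊥-elim (All.lookup x∉ (∈-lookup j) eq)
  lookup-injective (x∉ ∷ _) (suc i) zero eq = ⊥-elim (All.lookup x∉ (∈-lookup i) (≡.sym eq))
  lookup-injective (_ ∷ uniq) (suc i) (suc j) eq = cong suc (lookup-injective uniq i j eq)

  Unique⇒length≤ : ∀ {xs : List (Fin n)} → Unique xs → length xs ≤ n
  Unique⇒length≤ {xs} uniq = ≮⇒≥ λ n<length →
    let (i , j , i<j , eq) = pigeonhole n<length (lookup xs)
    in <-irrefl (lookup-injective uniq i j eq) i<j

  any-list≤? : ∀ k {P : List (Fin n) → Set} → (∀ xs → Dec (P xs)) → Dec (∃[ xs ] (length xs ≤ k × P xs))
  any-list≤? zero P? = map′ (λ p → [] , z≤n , p) (λ { ([] , _ , p) → p ; (_ ∷ _ , () , _) }) (P? [])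
  any-list≤? (suc k) P? with P? [] | any? (λ x → any-list≤? k (λ xs → P? (x ∷ xs)))
  ... | yes p | _ = yes ([] , z≤n , p)
  ... | no _ | yes (x , xs , ≤k , p) = yes (x ∷ xs , s≤s ≤k , p)
  ... | no ¬p | no ¬q = no λ { ([] , _ , p) → ¬p p ; (x ∷ xs , s≤s ≤k , p) → ¬q (x , xs , ≤k , p) }

module DPaths {n : ℕ} (G : Graph n) (F D : Subset n) where

  open UniqueDec {A = Fin n} _≟_ using (unique?)
  open MembershipDec {A = Fin n} _≟_ using () renaming (_∈?_ to _∈ₗ?_)

  Route : Fin n → Fin n → Fin n → Set
  Route v w y = ∃[ xs ] (DPath G F D v xs w × y ∈ₗ vertices v xs w)

  Leg : Fin n → Fin n → Set
  Leg v y = ∃[ w ] (w ∈ D × Degree1K G F D w × Route v w y)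

  AssocV⇒QVertex : ∀ {x v} → AssocV G F D x v → QVertex G F D v
  AssocV⇒QVertex (_ , qv , _) = qv

  AssocE⇒QEdge : ∀ {x v w} → AssocE G F D x v w → QEdge G F D v w
  AssocE⇒QEdge (_ , e , _) = e

  AssocE⇒QVertexˡ : ∀ {x v w} → AssocE G F D x v w → QVertex G F D v
  AssocE⇒QVertexˡ (_ , (qv , _) , _) = qv

  AssocE⇒QVertexʳ : ∀ {x v w} → AssocE G F D x v w → QVertex G F D w
  AssocE⇒QVertexʳ (_ , (_ , qw , _) , _) = qw

  AssocE⇒≢ : ∀ {x v w} → AssocE G F D x v w → v ≢ w
  AssocE⇒≢ (_ , (_ , _ , v≢w , _) , _) = v≢w

  Adj⇒QEdge : ∀ {u v} → QVertex G F D u → QVertex G F D v → Adj G u v → QEdge G F D u v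
  Adj⇒QEdge qu@(u∉F , _) qv@(v∉F , _) e =
    qu , qv , u≢v , [] , last e , (u≢v ∷ []) ∷ [] ∷ [] , u∉F ∷ v∉F ∷ [] , []
    where
    u≢v : _ ≢ _
    u≢v refl = irrefl G e

  ∉D⇒endpoint : ∀ {u xs v y} → All (_∈ D) xs → y ∉ D → y ∈ₗ vertices u xs v → y ≡ u ⊎ y ≡ v
  ∉D⇒endpoint _ _ (here y≡u) = inj₁ y≡u
  ∉D⇒endpoint {xs = xs} xs⊆D y∉D (there y∈) with ∈-++⁻ xs y∈
  ... | inj₁ y∈xs = ⊥-elim (y∉D (All.lookup xs⊆D y∈xs))
  ... | inj₂ (here y≡v) = inj₂ y≡v

  -- y and the predecessor of w on the path are both the unique neighbour of w outside F
  degree1-end-neighbour : ∀ {u xs w y} → DPath G F D u xs w → Degree1K G F D w →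
    y ∉ F → Adj G w y → y ∈ₗ vertices u xs w
  degree1-end-neighbour (c , _ , ∉F , _) (_ , _ , _ , _ , only) y∉F e =
    let (p , p∈ , ep) = Chain-last c
        p∈′ = ∈-++⁺ˡ p∈
    in subst (_∈ₗ vertices _ _ _) (≡.trans (only p (All.lookup ∉F p∈′) (sym G ep)) (≡.sym (only _ y∉F e))) p∈′

  reverse-vertices : ∀ (u : Fin n) xs v → reverse (vertices u xs v) ≡ vertices v (reverse xs) u
  reverse-vertices u xs v = begin
    reverse (u ∷ xs ++ v ∷ [])   ≡⟨ unfold-reverse u (xs ++ v ∷ []) ⟩
    reverse (xs ++ v ∷ []) ∷ʳ u  ≡⟨ cong (_∷ʳ u) (reverse-++ xs (v ∷ [])) ⟩
    v ∷ reverse xs ++ u ∷ []     ∎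
    where open ≡-Reasoning

  vertices-↭ : ∀ (u : Fin n) xs v → vertices u xs v ↭ vertices v (reverse xs) u
  vertices-↭ u xs v = subst (vertices u xs v ↭_) (reverse-vertices u xs v) (↭-sym (↭-reverse _))

  DPath-reverse : ∀ {u xs v} → DPath G F D u xs v → DPath G F D v (reverse xs) u
  DPath-reverse {u} {xs} {v} (c , uniq , ∉F , ⊆D) =
    Chain-reverse (sym G) c ,
    Unique-resp-↭ (↭⇒↭ₛ (vertices-↭ u xs v)) uniq ,
    All-resp-↭ (vertices-↭ u xs v) ∉F ,
    All-resp-↭ (↭-sym (↭-reverse xs)) ⊆D
    where open SetoidPermutation (≡.setoid (Fin n)) using (Unique-resp-↭)

  Route-reverse : ∀ {v w y} → Route v w y → Route w v y
  Route-reverse {v} {w} (xs , path , y∈) = reverse xs , DPath-reverse path , ∈-resp-↭ (vertices-↭ v xs w) y∈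

  AssocE-reverse : ∀ {x v w} → AssocE G F D x v w → AssocE G F D x w v
  AssocE-reverse (x∈D , (qv , qw , v≢w , ys , path) , route) =
    x∈D , (qw , qv , ≢-sym v≢w , reverse ys , DPath-reverse path) , Route-reverse route

  DPath-length≤ : ∀ {u xs v} → DPath G F D u xs v → length xs ≤ n
  DPath-length≤ {xs = xs} (_ , uniq , _) = ≤-trans (m≤n⇒m≤1+n (length-++-≤ˡ xs)) (Unique⇒length≤ uniq)

  dpath? : ∀ u xs v → Dec (DPath G F D u xs v)
  dpath? u xs v =
    chain? (adj? G) u xs v ×-dec unique? (vertices u xs v) ×-dec
    All.all? (λ y → ¬? (y ∈? F)) (vertices u xs v) ×-dec All.all? (_∈? D) xs

  -- DPaths have no repeated vertices, so the search can stop at length n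
  any-DPath? : ∀ u v {R : List (Fin n) → Set} → (∀ xs → Dec (R xs)) →
    Dec (∃[ xs ] (DPath G F D u xs v × R xs))
  any-DPath? u v R? = map′ (λ (xs , _ , p) → xs , p) (λ (xs , p) → xs , DPath-length≤ (proj₁ p) , p)
    (any-list≤? n (λ xs → dpath? u xs v ×-dec R? xs))

  route? : ∀ v w y → Dec (Route v w y)
  route? v w y = any-DPath? v w (λ xs → y ∈ₗ? vertices v xs w)

  qvertex? : ∀ v → Dec (QVertex G F D v)
  qvertex? v = ¬? (v ∈? F) ×-dec ¬? (v ∈? D)

  qedge? : ∀ u v → Dec (QEdge G F D u v)
  qedge? u v = qvertex? u ×-dec qvertex? v ×-dec ¬? (u ≟ v) ×-dec
    map′ (λ (xs , p , _) → xs , p) (λ (xs , p) → xs , p , tt) (any-DPath? u v (λ _ → yes tt))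

  degree1K? : ∀ w → Dec (Degree1K G F D w)
  degree1K? w = ¬? (w ∈? F) ×-dec any? λ y → ¬? (y ∈? F) ×-dec adj? G w y ×-dec
    all? (λ z → ¬? (z ∈? F) →-dec (adj? G w z →-dec (z ≟ y)))

  assocV? : ∀ x v → Dec (AssocV G F D x v)
  assocV? x v = x ∈? D ×-dec qvertex? v ×-dec any? (λ w → w ∈? D ×-dec degree1K? w ×-dec route? v w x)

  assocE? : ∀ x v w → Dec (AssocE G F D x v w)
  assocE? x v w = x ∈? D ×-dec qedge? v w ×-dec route? v w x

module Association {n : ℕ} (G : Graph n) (F D : Subset n)
  (F∩D=∅ : ∀ x → x ∈ F → x ∈ D → ⊥)
  (two-neighbours : ∀ v → v ∈ D → ∀ a b c → a ∉ F → b ∉ F → c ∉ F →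
     Adj G v a → Adj G v b → Adj G v c → a ≢ b → a ≢ c → b ≢ c → ⊥) where

  open DPaths G F D public

  ∈D⇒∉F : ∀ {x} → x ∈ D → x ∉ F
  ∈D⇒∉F {x} x∈D x∈F = F∩D=∅ x x∈F x∈D

  neighbour-among : ∀ {x p s y} → x ∈ D → p ∉ F → s ∉ F → y ∉ F →
    Adj G x p → Adj G x s → Adj G x y → p ≢ s → y ≡ p ⊎ y ≡ s
  neighbour-among {x} {p} {s} {y} x∈D p∉F s∉F y∉F ep es ey p≢s with y ≟ p | y ≟ s
  ... | yes y≡p | _ = inj₁ y≡p
  ... | no _ | yes y≡s = inj₂ y≡s
  ... | no y≢p | no y≢s =
    ⊥-elim (two-neighbours x x∈D p s y p∉F s∉F y∉F ep es ey p≢s (≢-sym y≢p) (≢-sym y≢s))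

  internal-neighbour : ∀ {u xs v x y} → DPath G F D u xs v → x ∈ₗ xs →
    y ∉ F → Adj G x y → y ∈ₗ vertices u xs v
  internal-neighbour (c , uniq , ∉F , ⊆D) x∈ y∉F ey with Chain-neighbours (sym G) c uniq x∈
  ... | p , s , p∈ , s∈ , ep , es , p≢s
    with neighbour-among (All.lookup ⊆D x∈) (All.lookup ∉F p∈) (All.lookup ∉F s∈) y∉F ep es ey p≢s
  ... | inj₁ refl = p∈
  ... | inj₂ refl = s∈

  leg-neighbour : ∀ {x v y} → AssocV G F D x v → y ∉ F → Adj G x y → Leg v y
  leg-neighbour (x∈D , (_ , v∉D) , w , w∈D , deg , xs , path , x∈) y∉F e with x∈
  ... | here refl = ⊥-elim (v∉D x∈D)
  ... | there x∈′ with ∈-++⁻ xs x∈′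
  ... | inj₁ x∈xs = w , w∈D , deg , xs , path , internal-neighbour path x∈xs y∉F e
  ... | inj₂ (here refl) = w , w∈D , deg , xs , path , degree1-end-neighbour path deg y∉F e

  route-internal : ∀ {x v w} → AssocE G F D x v w → ∃[ xs ] (DPath G F D v xs w × x ∈ₗ xs)
  route-internal (x∈D , ((_ , v∉D) , (_ , w∉D) , _) , xs , path , x∈) with x∈
  ... | here refl = ⊥-elim (v∉D x∈D)
  ... | there x∈′ with ∈-++⁻ xs x∈′
  ... | inj₁ x∈xs = xs , path , x∈xs
  ... | inj₂ (here refl) = ⊥-elim (w∉D x∈D)

  route-neighbour : ∀ {x v w y} → AssocE G F D x v w → y ∉ F → Adj G x y → Route v w y
  route-neighbour a y∉F e =
    let (xs , path , x∈xs) = route-internal a in xs , path , internal-neighbour path x∈xs y∉F e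

  D-Closed : (Fin n → Set) → Set
  D-Closed Q = ∀ {a b} → Q a → Adj G a b → b ∈ D → Q b

  assocV-D-closed : ∀ {v} → D-Closed (λ x → AssocV G F D x v)
  assocV-D-closed a@(_ , qv , _) e b∈D = b∈D , qv , leg-neighbour a (∈D⇒∉F b∈D) e

  assocE-D-closed : ∀ {v w} → D-Closed (λ x → AssocE G F D x v w)
  assocE-D-closed a@(_ , qe , _) e b∈D = b∈D , qe , route-neighbour a (∈D⇒∉F b∈D) e

  assocV-exit : ∀ {x v y} → AssocV G F D x v → QVertex G F D y → Adj G x y → y ≡ v
  assocV-exit a (y∉F , y∉D) e with leg-neighbour a y∉F e
  ... | _ , w∈D , _ , _ , (_ , _ , _ , xs⊆D) , y∈ with ∉D⇒endpoint xs⊆D y∉D y∈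
  ... | inj₁ y≡v = y≡v
  ... | inj₂ refl = ⊥-elim (y∉D w∈D)

  assocE-exit : ∀ {x v w y} → AssocE G F D x v w → QVertex G F D y → Adj G x y → y ≡ v ⊎ y ≡ w
  assocE-exit a (y∉F , y∉D) e =
    let (_ , (_ , _ , _ , xs⊆D) , y∈) = route-neighbour a y∉F e in ∉D⇒endpoint xs⊆D y∉D y∈

  leg-start : ∀ {Q x v} → D-Closed Q → AssocV G F D x v → Q x → ∃[ z ] (Adj G v z × Q z)
  leg-start closed (x∈D , (_ , v∉D) , _ , _ , _ , _ , (c , _ , _ , xs⊆D) , x∈) qx with x∈
  ... | here refl = ⊥-elim (v∉D x∈D)
  ... | there x∈′ = Chain-backtrack (λ q e → closed q (sym G e)) c xs⊆D (lose x∈′ qx)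

  route-start : ∀ {Q x v w} → D-Closed Q → AssocE G F D x v w → Q x → ∃[ z ] (Adj G v z × Q z)
  route-start closed a qx =
    let (_ , (c , _ , _ , xs⊆D) , x∈xs) = route-internal a
    in Chain-backtrack (λ q e → closed q (sym G e)) c xs⊆D (lose (∈-++⁺ˡ x∈xs) qx)

  assocV-unique : ∀ {x v v′} → AssocV G F D x v → AssocV G F D x v′ → v ≡ v′
  assocV-unique a b =
    let (_ , e , q) = leg-start assocV-D-closed a b in assocV-exit q (AssocV⇒QVertex a) (sym G e)

  assocE-start : ∀ {x v w v′ w′} → AssocE G F D x v w → AssocE G F D x v′ w′ → v ≡ v′ ⊎ v ≡ w′
  assocE-start a b =
    let (_ , e , q) = route-start assocE-D-closed a b in assocE-exit q (AssocE⇒QVertexˡ a) (sym G e)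

  assocE-unique : ∀ {x v w v′ w′} → AssocE G F D x v w → AssocE G F D x v′ w′ →
    (v ≡ v′ × w ≡ w′) ⊎ (v ≡ w′ × w ≡ v′)
  assocE-unique {v = v} {w} {v′} {w′} a b = combine (assocE-start a b) (assocE-start (AssocE-reverse a) b)
    where
    combine : v ≡ v′ ⊎ v ≡ w′ → w ≡ v′ ⊎ w ≡ w′ → (v ≡ v′ × w ≡ w′) ⊎ (v ≡ w′ × w ≡ v′)
    combine (inj₁ v≡v′) (inj₂ w≡w′) = inj₁ (v≡v′ , w≡w′)
    combine (inj₂ v≡w′) (inj₁ w≡v′) = inj₂ (v≡w′ , w≡v′)
    combine (inj₁ v≡v′) (inj₁ w≡v′) = ⊥-elim (AssocE⇒≢ a (≡.trans v≡v′ (≡.sym w≡v′)))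
    combine (inj₂ v≡w′) (inj₂ w≡w′) = ⊥-elim (AssocE⇒≢ a (≡.trans v≡w′ (≡.sym w≡w′)))

  assocV-assocE-disjoint : ∀ {x v v′ w′} → AssocV G F D x v → AssocE G F D x v′ w′ → ⊥
  assocV-assocE-disjoint {x} {v} a b = AssocE⇒≢ b (≡.trans (start≡v b) (≡.sym (start≡v (AssocE-reverse b))))
    where
    start≡v : ∀ {s t} → AssocE G F D x s t → s ≡ v
    start≡v b′ =
      let (_ , e , q) = route-start assocV-D-closed b′ a in assocV-exit q (AssocE⇒QVertexˡ b′) (sym G e)

module Embedding {n m : ℕ} (G : Graph n) (F D : Subset n) (H : Graph m) (χ : Fin m → Fin n)
  (F∩D=∅ : ∀ x → x ∈ F → x ∈ D → ⊥)
  (two-neighbours : ∀ v → v ∈ D → ∀ a b c → a ∉ F → b ∉ F → c ∉ F →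
     Adj G v a → Adj G v b → Adj G v c → a ≢ b → a ≢ c → b ≢ c → ⊥)
  (χ-outside : ∀ a → χ a ∉ F × χ a ∉ D)
  (h̄ : (v : Fin n) → QVertex G F D v → Fin m)
  (h̄-embedding : IsQEmbedding G F D H h̄)
  (χ∘h̄ : ∀ v p → χ (h̄ v p) ≡ v) where

  open Association G F D F∩D=∅ two-neighbours
  open Product G F D H χ

  -- The four constructors correspond to the parts V₁, V₂, V₃, V₄ of the product graph.
  data Kind (x : Fin n) : Set where
    quotient : QVertex G F D x → Kind x
    fixed    : InP (r2 x) → Kind x
    leg      : ∀ {v} → AssocV G F D x v → Kind x
    route    : ∀ {v w} (a : AssocE G F D x v w) → h̄ v (AssocE⇒QVertexˡ a) < h̄ w (AssocE⇒QVertexʳ a) → Kind x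

  -- QVertex is a pair of maps into ⊥, which is definitionally proof-irrelevant, so h̄ v p
  -- does not depend on p up to definitional equality; the clauses below rely on this.
  oriented : ∀ {x v w} → AssocE G F D x v w → Kind x
  oriented {v = v} {w} a with <-cmp (h̄ v (AssocE⇒QVertexˡ a)) (h̄ w (AssocE⇒QVertexʳ a))
  ... | tri< lt _ _ = route a lt
  ... | tri≈ _ eq _ = ⊥-elim (AssocE⇒≢ a (proj₁ h̄-embedding v w _ _ eq))
  ... | tri> _ _ gt = route (AssocE-reverse a) gt

  kind : ∀ x → Kind x
  kind x with x ∈? F
  ... | yes x∈F = fixed (inj₁ x∈F)
  ... | no x∉F with x ∈? D
  ... | no x∉D = quotient (x∉F , x∉D)
  ... | yes x∈D with any? (assocV? x)
  ... | yes (_ , a) = leg a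
  ... | no ¬leg with any? (λ v → any? (assocE? x v))
  ... | yes (_ , _ , a) = oriented a
  ... | no ¬route = fixed (inj₂ (x∈D , (λ v a → ¬leg (v , a)) , (λ v w a → ¬route (v , w , a))))

  vertex : ∀ {x} → Kind x → PVertex
  vertex {x} (quotient p) = r1 (h̄ x p)
  vertex {x} (fixed _) = r2 x
  vertex {x} (leg {v} a) = r3 x (h̄ v (AssocV⇒QVertex a))
  vertex {x} (route {v} {w} a _) = r4 x (h̄ v (AssocE⇒QVertexˡ a)) (h̄ w (AssocE⇒QVertexʳ a))

  vertex-InP : ∀ {x} (k : Kind x) → InP (vertex k)
  vertex-InP {x} (quotient p) = χ-outside (h̄ x p)
  vertex-InP (fixed i) = i
  vertex-InP (leg {v} a) rewrite χ∘h̄ v (AssocV⇒QVertex a) = a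
  vertex-InP (route {v} {w} a lt) rewrite χ∘h̄ v (AssocE⇒QVertexˡ a) | χ∘h̄ w (AssocE⇒QVertexʳ a) =
    lt , proj₂ h̄-embedding v w _ _ (AssocE⇒QEdge a) , a

  base : PVertex → Fin n
  base (r1 a) = χ a
  base (r2 u) = u
  base (r3 u _) = u
  base (r4 u _ _) = u

  base-vertex : ∀ {x} (k : Kind x) → base (vertex k) ≡ x
  base-vertex {x} (quotient p) = χ∘h̄ x p
  base-vertex (fixed _) = refl
  base-vertex (leg _) = refl
  base-vertex (route _ _) = refl

  χ∘h̄-adj : ∀ {x y} (p : QVertex G F D x) → Adj G x y → Adj G (χ (h̄ x p)) y
  χ∘h̄-adj {x} p e = subst (λ z → Adj G z _) (≡.sym (χ∘h̄ x p)) e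

  quotient-edge : ∀ {x y} → Adj G x y → (p : QVertex G F D x) (l : Kind y) → PEdge0 (r1 (h̄ x p)) (vertex l)
  quotient-edge {x} {y} e p (quotient q) =
    e11 (subst₂ (Adj G) (≡.sym (χ∘h̄ x p)) (≡.sym (χ∘h̄ y q)) e) (proj₂ h̄-embedding x y p q (Adj⇒QEdge p q e))
  quotient-edge e p (fixed _) = e12 (χ∘h̄-adj p e)
  quotient-edge e p (leg a) with refl ← assocV-exit a p (sym G e) = e13 (χ∘h̄-adj p e)
  quotient-edge e p (route a _) with assocE-exit a p (sym G e)
  ... | inj₁ refl = e14 (χ∘h̄-adj p e) (inj₁ refl)
  ... | inj₂ refl = e14 (χ∘h̄-adj p e) (inj₂ refl)

  leg-edge : ∀ {x y v v′} → Adj G x y → (a : AssocV G F D x v) (b : AssocV G F D y v′) →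
    PEdge0 (r3 x (h̄ v (AssocV⇒QVertex a))) (r3 y (h̄ v′ (AssocV⇒QVertex b)))
  leg-edge e a b with refl ← assocV-unique (assocV-D-closed a e (proj₁ b)) b = e33 e

  route-edge : ∀ {x y v w v′ w′} → Adj G x y → (a : AssocE G F D x v w) (b : AssocE G F D y v′ w′) →
    (lt : h̄ v (AssocE⇒QVertexˡ a) < h̄ w (AssocE⇒QVertexʳ a)) →
    (lt′ : h̄ v′ (AssocE⇒QVertexˡ b) < h̄ w′ (AssocE⇒QVertexʳ b)) →
    PEdge0 (vertex (route a lt)) (vertex (route b lt′))
  route-edge {x} {y} {v} {w} {v′} {w′} e a b lt lt′ = same-route (assocE-unique (assocE-D-closed a e (proj₁ b)) b)
    where
    same-route : (v ≡ v′ × w ≡ w′) ⊎ (v ≡ w′ × w ≡ v′) → PEdge0 (vertex (route a lt)) (vertex (route b lt′))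
    same-route (inj₁ (refl , refl)) = e44 e
    same-route (inj₂ (refl , refl)) = ⊥-elim (<-asym lt lt′)

  vertex-edge : ∀ {x y} → Adj G x y → (k : Kind x) (l : Kind y) →
    PEdge0 (vertex k) (vertex l) ⊎ PEdge0 (vertex l) (vertex k)
  vertex-edge e (quotient p) l = inj₁ (quotient-edge e p l)
  vertex-edge e k (quotient q) = inj₂ (quotient-edge (sym G e) q k)
  vertex-edge e (fixed _) (fixed _) = inj₁ (e22 e)
  vertex-edge e (fixed _) (leg _) = inj₁ (e23 e)
  vertex-edge e (fixed _) (route _ _) = inj₁ (e24 e)
  vertex-edge e (leg _) (fixed _) = inj₂ (e23 (sym G e))
  vertex-edge e (route _ _) (fixed _) = inj₂ (e24 (sym G e))
  vertex-edge e (leg a) (leg b) = inj₁ (leg-edge e a b)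
  vertex-edge e (leg a) (route b _) = ⊥-elim (assocV-assocE-disjoint (assocV-D-closed a e (proj₁ b)) b)
  vertex-edge e (route a _) (leg b) = ⊥-elim (assocV-assocE-disjoint b (assocE-D-closed a e (proj₁ b)))
  vertex-edge e (route a lt) (route b lt′) = inj₁ (route-edge e a b lt lt′)

  embedding : Fin n → PVertex
  embedding x = vertex (kind x)

  embedding-injective : Injective embedding
  embedding-injective x y eq = begin
    x                   ≡⟨ base-vertex (kind x) ⟨
    base (embedding x)  ≡⟨ cong base eq ⟩
    base (embedding y)  ≡⟨ base-vertex (kind y) ⟩
    y                   ∎
    where open ≡-Reasoning

  embedding-isPEmbedding : IsPEmbedding embedding
  embedding-isPEmbedding =
    (λ x → vertex-InP (kind x)) ,
    embedding-injective ,
    λ x y e → vertex-InP (kind x) , vertex-InP (kind y) , vertex-edge e (kind x) (kind y)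

lemma4p11 : ∀ {n m : ℕ} (G : Graph n) (F D : Subset n) (H : Graph m)
    (χ : Fin m → Fin n) →
    IsSkeleton G F D →
    (∀ a → χ a ∉ F × χ a ∉ D) →
    (∃[ hbar ] (IsQEmbedding G F D H hbar ×
      (∀ v (p : QVertex G F D v) → χ (hbar v p) ≡ v))) →
    ∃[ f ] Product.IsPEmbedding G F D H χ f
lemma4p11 G F D H χ (_ , F∩D=∅ , two-neighbours) χ-outside (h̄ , h̄-embedding , χ∘h̄) =
  embedding , embedding-isPEmbedding
  where open Embedding G F D H χ F∩D=∅ two-neighbours χ-outside h̄ h̄-embedding χ∘h̄
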